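{- Let $m<n$ be positive integers, $F$ a finite field, $D_k=D_k(a_1,\ldots,a_{n-1})$ an element of $\mathcal{D}$, and $A$ an element of a maximal independent set $M$ of $\Gamma(M_n(F))$ with $\mathcal{D}\subseteq M$. Then for every set $S\subseteq\{1,\dots,n\}$ with $|S|=m$, the $n\times n$ matrix whose $i$-th row is the $i$-th row of $D_k$ for $i\in S$ and the $i$-th row of $A$ for $i\notin S$ is not invertible.
   Context: For $1\leq k,l\leq n$ and $a_1,\dots,a_{n-1}\in F$, $D_{k,l}(a_1,\ldots,a_{n-1})$ denotes the $n\times n$ matrix over $F$ whose $(i,j)$ entry is $a_{i-l}$ if $j-i\equiv k \pmod n$ and $i\neq l$, and $0$ otherwise; indices are taken modulo $n$ with representatives in $\{1,\dots,n\}$. Set $D_k(a_1,\ldots,a_{n-1})=D_{k,k}(a_1,\ldots,a_{n-1})$ and $\mathcal{D}=\{D_k(a_1,\ldots,a_{n-1}) : 1\leq k\leq n,\ a_i\in F\}$ (an independent set). The unitary Cayley graph $\Gamma(M_n(F))$ has vertex set $M_n(F)$, with distinct $X,Y$ adjacent iff $X-Y$ is invertible. -}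

module Defs where

open import Level using (_⊔_)
open import Algebra.Bundles using (CommutativeRing)
open import Data.Nat as ℕ using (ℕ; zero; suc; _∸_; _%_)
open import Data.Fin as Fin using (Fin; toℕ)
open import Data.Fin.Subset using (Subset)
open import Data.Vec using (lookup)
open import Data.Bool using (Bool; true; false; if_then_else_; _∧_; not)
open import Data.Product using (Σ; ∃; _×_)
open import Relation.Nullary using (¬_; does)
open import Relation.Binary using (Decidable)
import Algebra.Definitions.RawMonoid as RawMonoidDefs

-- x mod n (representative in {0,…,n-1}); only used with n ≥ 1.
_mod_ : ℕ → ℕ → ℕ
x mod zero    = x
x mod (suc n) = x % suc n

record IsFiniteField {c ℓ} (R : CommutativeRing c ℓ) : Set (c ⊔ ℓ) where
  open CommutativeRing R
  field
    0≉1       : ¬ (0# ≈ 1#)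
    inverse   : ∀ x → ¬ (x ≈ 0#) → ∃ λ y → x * y ≈ 1#
    _≟_       : Decidable _≈_
    size      : ℕ
    enum      : Fin size → Carrier
    enum-surj : ∀ x → ∃ λ i → enum i ≈ x

module Mat {c ℓ} (R : CommutativeRing c ℓ) where
  open CommutativeRing R
  open RawMonoidDefs +-rawMonoid using (sum)

  -- n×n matrices over R; row/column index i : Fin n stands for paper index toℕ i + 1
  Matrix : ℕ → Set c
  Matrix n = Fin n → Fin n → Carrier

  _≈ₘ_ : ∀ {n} → Matrix n → Matrix n → Set ℓ
  X ≈ₘ Y = ∀ i j → X i j ≈ Y i j

  _-ₘ_ : ∀ {n} → Matrix n → Matrix n → Matrix n
  (X -ₘ Y) i j = X i j - Y i j

  _*ₘ_ : ∀ {n} → Matrix n → Matrix n → Matrix n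
  (X *ₘ Y) i j = sum (λ t → X i t * Y t j)

  Iₘ : ∀ {n} → Matrix n
  Iₘ i j = if does (i Fin.≟ j) then 1# else 0#

  Invertible : ∀ {n} → Matrix n → Set (c ⊔ ℓ)
  Invertible {n} X = Σ (Matrix n) λ Y → (X *ₘ Y) ≈ₘ Iₘ × (Y *ₘ X) ≈ₘ Iₘ

  Adjacent : ∀ {n} → Matrix n → Matrix n → Set (c ⊔ ℓ)
  Adjacent X Y = ¬ (X ≈ₘ Y) × Invertible (X -ₘ Y)

  IsIndependent : ∀ {n p} → (Matrix n → Set p) → Set (c ⊔ ℓ ⊔ p)
  IsIndependent M = ∀ X Y → M X → M Y → ¬ Adjacent X Y

  IsMaximalIndependent : ∀ {n p} → (Matrix n → Set p) → Set (c ⊔ ℓ ⊔ p)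
  IsMaximalIndependent {n} M =
    IsIndependent M × (∀ Z → (∀ Y → M Y → ¬ Adjacent Z Y) → M Z)

  -- D_{k,l}(a_1,…,a_{n-1}) with k, l ∈ {1,…,n} (as ℕ); the sequence a is
  -- given as a : ℕ → Carrier, of which only a 1, …, a (n-1) are used.
  -- Entry (i,j) (paper indices I = toℕ i + 1, J = toℕ j + 1) is
  -- a_{(I - L) mod n} if J - I ≡ K (mod n) and I ≠ L, and 0 otherwise.
  Dkl : (n k l : ℕ) → (ℕ → Carrier) → Matrix n
  Dkl n k l a i j =
    if does (((J ℕ.+ n) ∸ I) mod n ℕ.≟ k mod n) ∧ not (does (I ℕ.≟ l))
    then a (((I ℕ.+ n) ∸ l) mod n)
    else 0#
    where
      I J : ℕ
      I = suc (toℕ i)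
      J = suc (toℕ j)

  D : (n k : ℕ) → (ℕ → Carrier) → Matrix n
  D n k a = Dkl n k k a

  rowMix : ∀ {n} → Subset n → Matrix n → Matrix n → Matrix n
  rowMix S X Y i j = if lookup S i then X i j else Y i j

-- Row i of D_k(b) is b_{ρ(i)} times a fixed row P_i, where ρ(i) = (i - k) mod n is injective.
-- Suppose the mixed matrix B, with rows of D_k(a) on S and rows of A elsewhere, were invertible,
-- and view each A-row as a row of A - D_k(b) with b = 0. Take i ∈ S with inverse Y of B.
-- Replacing row i of B by a row x multiplies B on the left by I + e_i(xY - e_i), so the result
-- stays invertible as soon as (xY)_i is nonzero. For x = A_i - t P_i we get
-- (xY)_i = (A_i Y)_i - t (P_i Y)_i, and (P_i Y)_i ≠ 0 because B_i = a_{ρ(i)} P_i and (B Y)_ii = 1;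
-- so some t ∈ {0, 1} works, and the new row is row i of A - D_k(b[ρ(i) ≔ t]), while the
-- injectivity of ρ keeps all other rows unchanged. After |S| steps A - D_k(b) is invertible
-- for some b, which contradicts the independence of M (a zero difference is singular).

module Submission where

open import Defs
open import Algebra.Bundles using (CommutativeRing)
open import Data.Nat using (ℕ; _≤_; _<_)
open import Data.Fin.Subset using (Subset; ∣_∣)
open import Relation.Binary.PropositionalEquality using (_≡_)
open import Relation.Nullary using (¬_)

import Algebra.Properties.CommutativeSemigroup as CommutativeSemigroupProperties
import Data.Nat as ℕ
open import Data.Nat.Induction using (<-wellFounded)
open import Data.Bool using (true; false; if_then_else_)
open import Data.Empty using (⊥; ⊥-elim)
open import Data.Fin as Fin using (Fin; zero; suc; toℕ)
import Data.Fin.Subset as Subset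
open import Data.Fin.Subset using (_∈_; Empty; Nonempty; outside)
open import Data.Fin.Subset.Properties using (p─⊥≡p; Empty-unique; nonempty?; x∈p⇒∣p-x∣<∣p∣)
open import Data.Product using (∃; _,_; proj₁; proj₂)
open import Data.Vec using (_∷_; lookup)
open import Data.Vec.Functional using (Vector)
open import Data.Vec.Properties using (lookup-replicate; []=⇒lookup)
open import Function using (_∘_)
open import Function.Definitions using (Injective)
open import Induction.WellFounded using (Acc; acc)
open import Relation.Binary.Bundles using (Setoid)
open import Relation.Binary.Definitions using (Decidable)
import Relation.Binary.PropositionalEquality as ≡
open import Relation.Binary.PropositionalEquality using (_≢_)
import Relation.Binary.Reasoning.Setoid as SetoidReasoning
open import Relation.Nullary using (Dec; does; yes; no)
open import Relation.Nullary.Decidable using (dec-true; dec-false)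

module _ where
  open import Data.Nat using (zero; suc; _+_; _*_; _∸_; _%_; NonZero)
  open import Data.Nat.Properties using (+-assoc; +-suc; +-∸-assoc; m+[n∸m]≡n; m≤m*n; m≤n⇒m≤1+n)
  open import Data.Nat.DivMod using ([m+kn]%n≡m%n; %-distribˡ-+; m<n⇒m%n≡m)
  open import Data.Fin.Properties using (toℕ-injective; toℕ<n)
  open ≡ using (cong; sym; trans; module ≡-Reasoning)

  %-+-cancelʳ : ∀ {d} .{{_ : NonZero d}} x y c → (x + c) % d ≡ (y + c) % d → x % d ≡ y % d
  %-+-cancelʳ {d} x y c [x+c]≡[y+c] = begin
    x % d                            ≡⟨ [m+kn]%n≡m%n x c d ⟨
    (x + c * d) % d                  ≡⟨ cong (_% d) (regroup x) ⟩
    (x + c + e) % d                  ≡⟨ %-distribˡ-+ (x + c) e d ⟩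
    ((x + c) % d + e % d) % d        ≡⟨ cong (λ r → (r + e % d) % d) [x+c]≡[y+c] ⟩
    ((y + c) % d + e % d) % d        ≡⟨ %-distribˡ-+ (y + c) e d ⟨
    (y + c + e) % d                  ≡⟨ cong (_% d) (regroup y) ⟨
    (y + c * d) % d                  ≡⟨ [m+kn]%n≡m%n y c d ⟩
    y % d                            ∎
    where
    open ≡-Reasoning
    e : ℕ
    e = c * d ∸ c
    regroup : ∀ z → z + c * d ≡ z + c + e
    regroup z = trans (cong (z +_) (sym (m+[n∸m]≡n (m≤m*n c d)))) (sym (+-assoc z c e))

  -- The paper's (i - k) mod n, written exactly as the coefficient index in row i of Dkl n k k.
  coefficientIndex : ∀ n → ℕ → Fin n → ℕ
  coefficientIndex n k i = ((suc (toℕ i) + n) ∸ k) mod n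

  coefficientIndex-injective : ∀ n {k} → k ≤ suc n → Injective _≡_ _≡_ (coefficientIndex (suc n) k)
  coefficientIndex-injective n {k} k≤n {i} {j} eq = toℕ-injective (begin
    toℕ i             ≡⟨ m<n⇒m%n≡m (toℕ<n i) ⟨
    toℕ i % suc n     ≡⟨ %-+-cancelʳ (toℕ i) (toℕ j) (suc (suc n) ∸ k)
                           (trans (sym (shift i)) (trans eq (shift j))) ⟩
    toℕ j % suc n     ≡⟨ m<n⇒m%n≡m (toℕ<n j) ⟩
    toℕ j             ∎)
    where
    open ≡-Reasoning
    shift : ∀ i → coefficientIndex (suc n) k i ≡ (toℕ i + (suc (suc n) ∸ k)) % suc n
    shift i = cong (_% suc n)
      (trans (cong (_∸ k) (sym (+-suc (toℕ i) (suc n)))) (+-∸-assoc (toℕ i) (m≤n⇒m≤1+n k≤n)))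

lookup-remove-self : ∀ {n} (S : Subset n) i → lookup (S Subset.- i) i ≡ false
lookup-remove-self (_ ∷ _) zero    = ≡.refl
lookup-remove-self (_ ∷ S) (suc i) = lookup-remove-self S i

lookup-remove-other : ∀ {n} (S : Subset n) {i j} → j ≢ i → lookup (S Subset.- i) j ≡ lookup S j
lookup-remove-other (_ ∷ _) {zero}  {zero}  j≢i = ⊥-elim (j≢i ≡.refl)
lookup-remove-other (_ ∷ S) {zero}  {suc j} _   = ≡.cong (λ T → lookup T j) (p─⊥≡p S)
lookup-remove-other (_ ∷ _) {suc _} {zero}  _   = ≡.refl
lookup-remove-other (_ ∷ S) {suc i} {suc j} j≢i = lookup-remove-other S (j≢i ∘ ≡.cong suc)

lookup-empty : ∀ {n} {S : Subset n} → Empty S → ∀ i → lookup S i ≡ false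
lookup-empty S-empty i rewrite Empty-unique S-empty = lookup-replicate i outside

_[_≔_] : ∀ {a} {A : Set a} → (ℕ → A) → ℕ → A → ℕ → A
(b [ k ≔ t ]) z = if does (z ℕ.≟ k) then t else b z

update-self : ∀ {a} {A : Set a} (b : ℕ → A) k t → (b [ k ≔ t ]) k ≡ t
update-self b k t rewrite dec-true (k ℕ.≟ k) ≡.refl = ≡.refl

update-other : ∀ {a} {A : Set a} (b : ℕ → A) {k z} t → z ≢ k → (b [ k ≔ t ]) z ≡ b z
update-other b {k} {z} t z≢k rewrite dec-false (z ℕ.≟ k) z≢k = ≡.refl

module _ {c ℓ} (R : CommutativeRing c ℓ) where
  open CommutativeRing R
  open import Algebra.Properties.Ring ring using (-0#≈0#; x∙y⁻¹≈ε⇒x≈y)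

  ∃[t]g-t*h≉0 : Decidable _≈_ → ∀ g {h} → ¬ h ≈ 0# → ∃ λ t → ¬ g - t * h ≈ 0#
  ∃[t]g-t*h≉0 _≟_ g {h} h≉0 with g ≟ 0#
  ... | yes g≈0 = 1# , λ g-1h≈0 → h≉0 (trans (trans (sym (*-identityˡ h)) (sym (x∙y⁻¹≈ε⇒x≈y g _ g-1h≈0))) g≈0)
  ... | no  g≉0 = 0# , λ g-0h≈0 → g≉0 (trans (sym g-0h≈g) g-0h≈0)
    where
    g-0h≈g : g - 0# * h ≈ g
    g-0h≈g = trans (+-congˡ (trans (-‿cong (zeroˡ h)) -0#≈0#)) (+-identityʳ g)

  if-then-0-scale : ∀ β x → (if β then x else 0#) ≈ x * (if β then 1# else 0#)
  if-then-0-scale true  x = sym (*-identityʳ x)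
  if-then-0-scale false x = sym (zeroʳ x)

  if-congʳ : ∀ β {x y z} → y ≈ z → (if β then x else y) ≈ (if β then x else z)
  if-congʳ true  _   = refl
  if-congʳ false y≈z = y≈z

module MatrixAlgebra {c ℓ} (R : CommutativeRing c ℓ) where
  open CommutativeRing R hiding (zero)
  open Mat R
  open import Algebra.Properties.Semiring.Sum semiring
    using (sum; sum-cong-≋; sum-replicate-zero; ∑-distrib-+; ∑-comm; *-distribˡ-sum; *-distribʳ-sum)
  open import Algebra.Properties.Ring ring
    using (-0#≈0#; -‿+-comm; -‿distribˡ-*; -‿distribʳ-*; [y-z]x≈yx-zx; xyx⁻¹≈y)
  private
    module +-CS = CommutativeSemigroupProperties +-commutativeSemigroup
    module *-CS = CommutativeSemigroupProperties *-commutativeSemigroup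
  module ≈-Reasoning = SetoidReasoning setoid

  infixl 7 _ᵥ*ₘ_
  _ᵥ*ₘ_ : ∀ {n} → Vector Carrier n → Matrix n → Vector Carrier n
  (v ᵥ*ₘ X) j = sum (λ t → v t * X t j)

  sum-zero : ∀ {n} (f : Vector Carrier n) → (∀ t → f t ≈ 0#) → sum f ≈ 0#
  sum-zero {n} f f≈0 = trans (sum-cong-≋ f≈0) (sum-replicate-zero n)

  sum-neg : ∀ {n} (f : Vector Carrier n) → sum (λ t → - f t) ≈ - sum f
  sum-neg {ℕ.zero} f = sym -0#≈0#
  sum-neg {ℕ.suc n} f = trans (+-congˡ (sum-neg (f ∘ suc))) (-‿+-comm _ _)

  sum-δˡ : ∀ {n} (i : Fin n) (f : Vector Carrier n) → sum (λ t → Iₘ i t * f t) ≈ f i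
  sum-δˡ zero f = begin
    1# * f zero + sum (λ t → 0# * f (suc t)) ≈⟨ +-cong (*-identityˡ _) (sum-zero _ (λ t → zeroˡ (f (suc t)))) ⟩
    f zero + 0#                              ≈⟨ +-identityʳ _ ⟩
    f zero                                   ∎
    where open ≈-Reasoning
  sum-δˡ (suc i) f = trans (+-cong (zeroˡ _) (sum-δˡ i (f ∘ suc))) (+-identityˡ _)

  sum-δʳ : ∀ {n} (j : Fin n) (f : Vector Carrier n) → sum (λ t → f t * Iₘ t j) ≈ f j
  sum-δʳ zero f = begin
    f zero * 1# + sum (λ t → f (suc t) * 0#) ≈⟨ +-cong (*-identityʳ _) (sum-zero _ (λ t → zeroʳ (f (suc t)))) ⟩
    f zero + 0#                              ≈⟨ +-identityʳ _ ⟩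
    f zero                                   ∎
    where open ≈-Reasoning
  sum-δʳ (suc j) f = trans (+-cong (zeroʳ _) (sum-δʳ j (f ∘ suc))) (+-identityˡ _)

  Iₘ-diagonal : ∀ {n} (i : Fin n) → Iₘ i i ≈ 1#
  Iₘ-diagonal zero    = refl
  Iₘ-diagonal (suc i) = Iₘ-diagonal i

  x+[y-x]≈y : ∀ x y → x + (y - x) ≈ y
  x+[y-x]≈y x y = trans (sym (+-assoc x y (- x))) (xyx⁻¹≈y x y)

  ᵥ*ₘ-congˡ : ∀ {n} {u v : Vector Carrier n} (X : Matrix n) → (∀ t → u t ≈ v t) →
              ∀ j → (u ᵥ*ₘ X) j ≈ (v ᵥ*ₘ X) j
  ᵥ*ₘ-congˡ X u≈v j = sum-cong-≋ (λ t → *-congʳ (u≈v t))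

  ᵥ*ₘ-congʳ : ∀ {n} (v : Vector Carrier n) {X Y : Matrix n} → X ≈ₘ Y →
              ∀ j → (v ᵥ*ₘ X) j ≈ (v ᵥ*ₘ Y) j
  ᵥ*ₘ-congʳ v X≈Y j = sum-cong-≋ (λ t → *-congˡ (X≈Y t j))

  ᵥ*ₘ-identityʳ : ∀ {n} (v : Vector Carrier n) j → (v ᵥ*ₘ Iₘ) j ≈ v j
  ᵥ*ₘ-identityʳ v j = sum-δʳ j v

  Iₘ-ᵥ*ₘ : ∀ {n} (i : Fin n) (X : Matrix n) j → (Iₘ i ᵥ*ₘ X) j ≈ X i j
  Iₘ-ᵥ*ₘ i X j = sum-δˡ i (λ t → X t j)

  ᵥ*ₘ-scale : ∀ {n} c (v : Vector Carrier n) (X : Matrix n) j →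
              ((λ t → c * v t) ᵥ*ₘ X) j ≈ c * (v ᵥ*ₘ X) j
  ᵥ*ₘ-scale c v X j =
    trans (sum-cong-≋ (λ t → *-assoc c (v t) (X t j))) (sym (*-distribˡ-sum c (λ t → v t * X t j)))

  ᵥ*ₘ-distrib-+ : ∀ {n} (u v : Vector Carrier n) (X : Matrix n) j →
                  ((λ t → u t + v t) ᵥ*ₘ X) j ≈ (u ᵥ*ₘ X) j + (v ᵥ*ₘ X) j
  ᵥ*ₘ-distrib-+ u v X j =
    trans (sum-cong-≋ (λ t → distribʳ (X t j) (u t) (v t))) (∑-distrib-+ (λ t → u t * X t j) (λ t → v t * X t j))

  ᵥ*ₘ-distrib-− : ∀ {n} (u v : Vector Carrier n) (X : Matrix n) j →
                  ((λ t → u t - v t) ᵥ*ₘ X) j ≈ (u ᵥ*ₘ X) j - (v ᵥ*ₘ X) j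
  ᵥ*ₘ-distrib-− u v X j = begin
    sum (λ t → (u t - v t) * X t j)               ≈⟨ sum-cong-≋ (λ t → [y-z]x≈yx-zx (X t j) (u t) (v t)) ⟩
    sum (λ t → u t * X t j - v t * X t j)         ≈⟨ ∑-distrib-+ (λ t → u t * X t j) (λ t → - (v t * X t j)) ⟩
    (u ᵥ*ₘ X) j + sum (λ t → - (v t * X t j))     ≈⟨ +-congˡ (sum-neg (λ t → v t * X t j)) ⟩
    (u ᵥ*ₘ X) j - (v ᵥ*ₘ X) j                     ∎
    where open ≈-Reasoning

  ᵥ*ₘ-assoc : ∀ {n} (v : Vector Carrier n) (X Y : Matrix n) j →
              ((v ᵥ*ₘ X) ᵥ*ₘ Y) j ≈ (v ᵥ*ₘ (X *ₘ Y)) j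
  ᵥ*ₘ-assoc v X Y j = begin
    sum (λ t → sum (λ s → v s * X s t) * Y t j)   ≈⟨ sum-cong-≋ (λ t → *-distribʳ-sum (Y t j) (λ s → v s * X s t)) ⟩
    sum (λ t → sum (λ s → v s * X s t * Y t j))   ≈⟨ ∑-comm (λ t s → v s * X s t * Y t j) ⟩
    sum (λ s → sum (λ t → v s * X s t * Y t j))   ≈⟨ sum-cong-≋ (λ s → trans (sum-cong-≋ (λ t → *-assoc (v s) (X s t) (Y t j)))
                                                                         (sym (*-distribˡ-sum (v s) (λ t → X s t * Y t j)))) ⟩
    sum (λ s → v s * (X *ₘ Y) s j)                ∎
    where open ≈-Reasoning

  ≈ₘ-setoid : ℕ → Setoid c ℓ
  ≈ₘ-setoid n = record
    { Carrier       = Matrix n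
    ; _≈_           = _≈ₘ_
    ; isEquivalence = record
      { refl  = λ _ _ → refl
      ; sym   = λ X≈Y i j → sym (X≈Y i j)
      ; trans = λ X≈Y Y≈Z i j → trans (X≈Y i j) (Y≈Z i j)
      }
    }

  module ≈ₘ-Reasoning {n} = SetoidReasoning (≈ₘ-setoid n)

  *ₘ-assoc : ∀ {n} (X Y Z : Matrix n) → ((X *ₘ Y) *ₘ Z) ≈ₘ (X *ₘ (Y *ₘ Z))
  *ₘ-assoc X Y Z i = ᵥ*ₘ-assoc (X i) Y Z

  *ₘ-identityˡ : ∀ {n} (X : Matrix n) → (Iₘ *ₘ X) ≈ₘ X
  *ₘ-identityˡ X i = Iₘ-ᵥ*ₘ i X

  *ₘ-congˡ : ∀ {n} (X : Matrix n) {Y Z : Matrix n} → Y ≈ₘ Z → (X *ₘ Y) ≈ₘ (X *ₘ Z)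
  *ₘ-congˡ X Y≈Z i = ᵥ*ₘ-congʳ (X i) Y≈Z

  *ₘ-congʳ : ∀ {n} (X : Matrix n) {Y Z : Matrix n} → Y ≈ₘ Z → (Y *ₘ X) ≈ₘ (Z *ₘ X)
  *ₘ-congʳ X Y≈Z i = ᵥ*ₘ-congˡ X (Y≈Z i)

  Invertible-cong : ∀ {n} {X Y : Matrix n} → X ≈ₘ Y → Invertible X → Invertible Y
  Invertible-cong X≈Y (X⁻¹ , XX⁻¹≈I , X⁻¹X≈I) =
    X⁻¹ , ≈ₘ-trans (*ₘ-congʳ X⁻¹ (≈ₘ-sym X≈Y)) XX⁻¹≈I
        , ≈ₘ-trans (*ₘ-congˡ X⁻¹ (≈ₘ-sym X≈Y)) X⁻¹X≈I
    where open Setoid (≈ₘ-setoid _) using () renaming (sym to ≈ₘ-sym; trans to ≈ₘ-trans)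

  Invertible-*ₘ : ∀ {n} {X Y : Matrix n} → Invertible X → Invertible Y → Invertible (X *ₘ Y)
  Invertible-*ₘ (X⁻¹ , XX⁻¹≈I , X⁻¹X≈I) (Y⁻¹ , YY⁻¹≈I , Y⁻¹Y≈I) =
    Y⁻¹ *ₘ X⁻¹ , cancel-middle _ _ _ _ YY⁻¹≈I XX⁻¹≈I , cancel-middle _ _ _ _ X⁻¹X≈I Y⁻¹Y≈I
    where
    cancel-middle : ∀ {n} (A B C D : Matrix n) → (B *ₘ C) ≈ₘ Iₘ → (A *ₘ D) ≈ₘ Iₘ →
                    ((A *ₘ B) *ₘ (C *ₘ D)) ≈ₘ Iₘ
    cancel-middle A B C D BC≈I AD≈I = begin
      (A *ₘ B) *ₘ (C *ₘ D)   ≈⟨ *ₘ-assoc A B (C *ₘ D) ⟩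
      A *ₘ (B *ₘ (C *ₘ D))   ≈⟨ *ₘ-congˡ A (*ₘ-assoc B C D) ⟨
      A *ₘ ((B *ₘ C) *ₘ D)   ≈⟨ *ₘ-congˡ A (*ₘ-congʳ D BC≈I) ⟩
      A *ₘ (Iₘ *ₘ D)         ≈⟨ *ₘ-congˡ A (*ₘ-identityˡ D) ⟩
      A *ₘ D                 ≈⟨ AD≈I ⟩
      Iₘ                     ∎
      where open ≈ₘ-Reasoning

  addToRow : ∀ {n} → Fin n → Vector Carrier n → Matrix n
  addToRow i v p q = Iₘ p q + Iₘ p i * v q

  addToRow-*ₘ : ∀ {n} (i : Fin n) v (X : Matrix n) p q →
                (addToRow i v *ₘ X) p q ≈ X p q + Iₘ p i * (v ᵥ*ₘ X) q
  addToRow-*ₘ i v X p q = begin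
    ((λ t → Iₘ p t + Iₘ p i * v t) ᵥ*ₘ X) q               ≈⟨ ᵥ*ₘ-distrib-+ (Iₘ p) (λ t → Iₘ p i * v t) X q ⟩
    (Iₘ p ᵥ*ₘ X) q + ((λ t → Iₘ p i * v t) ᵥ*ₘ X) q       ≈⟨ +-cong (Iₘ-ᵥ*ₘ p X q) (ᵥ*ₘ-scale (Iₘ p i) v X q) ⟩
    X p q + Iₘ p i * (v ᵥ*ₘ X) q                          ∎
    where open ≈-Reasoning

  ᵥ*ₘ-addToRow : ∀ {n} (i : Fin n) v w q → (v ᵥ*ₘ addToRow i w) q ≈ v q + v i * w q
  ᵥ*ₘ-addToRow i v w q = begin
    sum (λ t → v t * (Iₘ t q + Iₘ t i * w q))             ≈⟨ sum-cong-≋ (λ t → trans (distribˡ (v t) _ _)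
                                                               (+-congˡ (sym (*-assoc (v t) (Iₘ t i) (w q))))) ⟩
    sum (λ t → v t * Iₘ t q + v t * Iₘ t i * w q)         ≈⟨ ∑-distrib-+ (λ t → v t * Iₘ t q) (λ t → v t * Iₘ t i * w q) ⟩
    sum (λ t → v t * Iₘ t q) + sum (λ t → v t * Iₘ t i * w q)
                                                          ≈⟨ +-cong (sum-δʳ q v) (sym (*-distribʳ-sum (w q) (λ t → v t * Iₘ t i))) ⟩
    v q + sum (λ t → v t * Iₘ t i) * w q                  ≈⟨ +-congˡ (*-congʳ (sum-δʳ i v)) ⟩
    v q + v i * w q                                       ∎
    where open ≈-Reasoning

  addToRow-trivial : ∀ {n} (i : Fin n) v → (∀ q → v q ≈ 0#) → addToRow i v ≈ₘ Iₘ
  addToRow-trivial i v v≈0 p q = trans (+-congˡ (trans (*-congˡ (v≈0 q)) (zeroʳ _))) (+-identityʳ _)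

  addToRow-*ₘ-addToRow : ∀ {n} (i : Fin n) v w →
    (addToRow i v *ₘ addToRow i w) ≈ₘ addToRow i (λ q → w q + (v q + v i * w q))
  addToRow-*ₘ-addToRow i v w p q = begin
    (addToRow i v *ₘ addToRow i w) p q                         ≈⟨ addToRow-*ₘ i v (addToRow i w) p q ⟩
    (Iₘ p q + Iₘ p i * w q) + Iₘ p i * (v ᵥ*ₘ addToRow i w) q  ≈⟨ +-congˡ (*-congˡ (ᵥ*ₘ-addToRow i v w q)) ⟩
    (Iₘ p q + Iₘ p i * w q) + Iₘ p i * (v q + v i * w q)       ≈⟨ +-assoc _ _ _ ⟩
    Iₘ p q + (Iₘ p i * w q + Iₘ p i * (v q + v i * w q))       ≈⟨ +-congˡ (distribˡ (Iₘ p i) _ _) ⟨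
    Iₘ p q + Iₘ p i * (w q + (v q + v i * w q))                ∎
    where open ≈-Reasoning

  addToRow-invertible : ∀ {n} (i : Fin n) v δ → δ * (1# + v i) ≈ 1# → Invertible (addToRow i v)
  addToRow-invertible i v δ δ[1+vᵢ]≈1 =
    addToRow i w , (λ p q → trans (addToRow-*ₘ-addToRow i v w p q) (addToRow-trivial i _ vw≈0 p q))
      , (λ p q → trans (addToRow-*ₘ-addToRow i w v p q) (addToRow-trivial i _ wv≈0 p q))
    where
    w : Vector Carrier _
    w q = - (δ * v q)

    [1+vᵢ]δx≈x : ∀ x → δ * x + v i * (δ * x) ≈ x
    [1+vᵢ]δx≈x x = begin
      δ * x + v i * (δ * x)        ≈⟨ +-congʳ (*-identityˡ (δ * x)) ⟨
      1# * (δ * x) + v i * (δ * x) ≈⟨ distribʳ (δ * x) 1# (v i) ⟨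
      (1# + v i) * (δ * x)         ≈⟨ *-assoc (1# + v i) δ x ⟨
      (1# + v i) * δ * x           ≈⟨ *-congʳ (trans (*-comm (1# + v i) δ) δ[1+vᵢ]≈1) ⟩
      1# * x                       ≈⟨ *-identityˡ x ⟩
      x                            ∎
      where open ≈-Reasoning

    cancel : ∀ x → x + (- (δ * x) + - (v i * (δ * x))) ≈ 0#
    cancel x = trans (+-congˡ (trans (-‿+-comm _ _) (-‿cong ([1+vᵢ]δx≈x x)))) (-‿inverseʳ x)

    vw≈0 : ∀ q → w q + (v q + v i * w q) ≈ 0#
    vw≈0 q = trans (+-CS.x∙yz≈y∙xz (w q) (v q) _)
                   (trans (+-congˡ (+-congˡ (sym (-‿distribʳ-* (v i) (δ * v q))))) (cancel (v q)))

    wv≈0 : ∀ q → v q + (w q + w i * v q) ≈ 0#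
    wv≈0 q = trans (+-congˡ (+-congˡ (trans (sym (-‿distribˡ-* (δ * v i) (v q)))
                                             (-‿cong (*-CS.xy∙z≈y∙xz δ (v i) (v q))))))
                   (cancel (v q))

  replaceRow : ∀ {n} → Matrix n → Fin n → Vector Carrier n → Matrix n
  replaceRow X i x p = if does (p Fin.≟ i) then x else X p

  addToRow-*ₘ≈replaceRow : ∀ {n} {X Y : Matrix n} → (Y *ₘ X) ≈ₘ Iₘ → ∀ i x →
    (addToRow i (λ q → (x ᵥ*ₘ Y) q - Iₘ i q) *ₘ X) ≈ₘ replaceRow X i x
  addToRow-*ₘ≈replaceRow {X = X} {Y} YX≈I i x p q =
    trans (addToRow-*ₘ i v X p q) (trans (+-congˡ (*-congˡ (vX≈x-Xᵢ q))) (entry p))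
    where
    v : Vector Carrier _
    v q = (x ᵥ*ₘ Y) q - Iₘ i q

    vX≈x-Xᵢ : ∀ q → (v ᵥ*ₘ X) q ≈ x q - X i q
    vX≈x-Xᵢ q = begin
      (v ᵥ*ₘ X) q                            ≈⟨ ᵥ*ₘ-distrib-− (x ᵥ*ₘ Y) (Iₘ i) X q ⟩
      ((x ᵥ*ₘ Y) ᵥ*ₘ X) q - (Iₘ i ᵥ*ₘ X) q   ≈⟨ +-cong (ᵥ*ₘ-assoc x Y X q) (-‿cong (Iₘ-ᵥ*ₘ i X q)) ⟩
      (x ᵥ*ₘ (Y *ₘ X)) q - X i q             ≈⟨ +-congʳ (trans (ᵥ*ₘ-congʳ x YX≈I q) (ᵥ*ₘ-identityʳ x q)) ⟩
      x q - X i q                            ∎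
      where open ≈-Reasoning

    entry : ∀ p → X p q + Iₘ p i * (x q - X i q) ≈ replaceRow X i x p q
    entry p with p Fin.≟ i
    ... | yes ≡.refl = trans (+-congˡ (*-identityˡ _)) (x+[y-x]≈y (X p q) (x q))
    ... | no _       = trans (+-congˡ (zeroˡ _)) (+-identityʳ (X p q))

  replaceRow-invertible : ∀ {n} {B Y : Matrix n} → (B *ₘ Y) ≈ₘ Iₘ → (Y *ₘ B) ≈ₘ Iₘ →
    ∀ i x δ → δ * (x ᵥ*ₘ Y) i ≈ 1# → Invertible (replaceRow B i x)
  replaceRow-invertible {Y = Y} BY≈I YB≈I i x δ δ[xY]ᵢ≈1 =
    Invertible-cong (addToRow-*ₘ≈replaceRow YB≈I i x)
      (Invertible-*ₘ (addToRow-invertible i _ δ (trans (*-congˡ 1+[γ-1]≈γ) δ[xY]ᵢ≈1)) (Y , BY≈I , YB≈I))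
    where
    1+[γ-1]≈γ : 1# + ((x ᵥ*ₘ Y) i - Iₘ i i) ≈ (x ᵥ*ₘ Y) i
    1+[γ-1]≈γ = trans (+-congˡ (+-congˡ (-‿cong (Iₘ-diagonal i)))) (x+[y-x]≈y 1# _)

  0ₘ : ∀ {n} → Matrix n
  0ₘ _ _ = 0#

  0ₘ-singular : ∀ {n} → ¬ 0# ≈ 1# → ¬ Invertible (0ₘ {ℕ.suc n})
  0ₘ-singular 0≉1 (Z , 0Z≈I , _) =
    0≉1 (trans (sym (sum-zero _ (λ t → zeroˡ (Z t zero)))) (0Z≈I zero zero))

  ≈ₘ⇒-ₘ≈0ₘ : ∀ {n} {X Y : Matrix n} → X ≈ₘ Y → (X -ₘ Y) ≈ₘ 0ₘ
  ≈ₘ⇒-ₘ≈0ₘ X≈Y i j = trans (+-congˡ (-‿cong (sym (X≈Y i j)))) (-‿inverseʳ _)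

  independent⇒-ₘ-singular : ∀ {n p} {M : Matrix (ℕ.suc n) → Set p} → ¬ 0# ≈ 1# → IsIndependent M →
                            ∀ {X Y} → M X → M Y → ¬ Invertible (X -ₘ Y)
  independent⇒-ₘ-singular 0≉1 independent X∈M Y∈M inv =
    independent _ _ X∈M Y∈M ((λ X≈Y → 0ₘ-singular 0≉1 (Invertible-cong (≈ₘ⇒-ₘ≈0ₘ X≈Y) inv)) , inv)

  rowMix-inside : ∀ {n} (S : Subset n) (X Y : Matrix n) p q → lookup S p ≡ true → rowMix S X Y p q ≡ X p q
  rowMix-inside S X Y p q Sₚ≡true rewrite Sₚ≡true = ≡.refl

  rowMix-outside : ∀ {n} (S : Subset n) (X Y : Matrix n) p q → lookup S p ≡ false → rowMix S X Y p q ≡ Y p q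
  rowMix-outside S X Y p q Sₚ≡false rewrite Sₚ≡false = ≡.refl

  rowMix-cong-row : ∀ {n} (S S′ : Subset n) (X Y Y′ : Matrix n) p q → lookup S p ≡ lookup S′ p →
                    Y p q ≈ Y′ p q → rowMix S X Y p q ≈ rowMix S′ X Y′ p q
  rowMix-cong-row S S′ X Y Y′ p q Sₚ≡S′ₚ Yₚ≈Y′ₚ rewrite Sₚ≡S′ₚ = if-congʳ R (lookup S′ p) Yₚ≈Y′ₚ

  rowMix-empty : ∀ {n} {S : Subset n} → Empty S → ∀ X Y → rowMix S X Y ≈ₘ Y
  rowMix-empty {S = S} S-empty X Y p q = reflexive (rowMix-outside S X Y p q (lookup-empty S-empty p))

  D-rowScaled : ∀ n k b i j → D n k b i j ≈ b (coefficientIndex n k i) * D n k (λ _ → 1#) i j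
  D-rowScaled n k b i j = if-then-0-scale R _ (b (coefficientIndex n k i))

module _ {c ℓ} (R : CommutativeRing c ℓ) where
  open CommutativeRing R
  open Mat R
  open MatrixAlgebra R
  open import Algebra.Properties.Ring ring using (-0#≈0#)

  module RowScaledFamily
    (0≉1 : ¬ 0# ≈ 1#) (inverse : ∀ x → ¬ x ≈ 0# → ∃ λ y → x * y ≈ 1#) (_≟_ : Decidable _≈_)
    {n} (D : (ℕ → Carrier) → Matrix n) (ρ : Fin n → ℕ) (ρ-injective : Injective _≡_ _≡_ ρ)
    (P : Matrix n) (D≈bρ*P : ∀ b i j → D b i j ≈ b (ρ i) * P i j)
    (A : Matrix n) (A-D-singular : ∀ b → ¬ Invertible (A -ₘ D b))
    where

    D-update-self : ∀ b i t j → D (b [ ρ i ≔ t ]) i j ≈ t * P i j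
    D-update-self b i t j = trans (D≈bρ*P _ i j) (*-congʳ (reflexive (update-self b (ρ i) t)))

    D-update-other : ∀ b {i p} t j → p ≢ i → D (b [ ρ i ≔ t ]) p j ≈ D b p j
    D-update-other b {i} {p} t j p≢i = begin
      D (b [ ρ i ≔ t ]) p j        ≈⟨ D≈bρ*P _ p j ⟩
      (b [ ρ i ≔ t ]) (ρ p) * P p j ≈⟨ *-congʳ (reflexive (update-other b t (p≢i ∘ ρ-injective))) ⟩
      b (ρ p) * P p j              ≈⟨ D≈bρ*P b p j ⟨
      D b p j                      ∎
      where open ≈-Reasoning

    invertible-rowMix-remove : ∀ a S b {i} → i ∈ S → Invertible (rowMix S (D a) (A -ₘ D b)) →
                               ∃ λ b′ → Invertible (rowMix (S Subset.- i) (D a) (A -ₘ D b′))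
    invertible-rowMix-remove a S b {i} i∈S (Y , BY≈I , YB≈I) =
      b′ , Invertible-cong replaced≈mixed (replaceRow-invertible BY≈I YB≈I i x δ δγ≈1)
      where
      B : Matrix n
      B = rowMix S (D a) (A -ₘ D b)

      Bᵢ≈aᵢPᵢ : ∀ q → B i q ≈ a (ρ i) * P i q
      Bᵢ≈aᵢPᵢ q = trans (reflexive (rowMix-inside S (D a) (A -ₘ D b) i q ([]=⇒lookup i∈S))) (D≈bρ*P a i q)

      g h : Carrier
      g = (A i ᵥ*ₘ Y) i
      h = (P i ᵥ*ₘ Y) i

      aᵢh≈1 : a (ρ i) * h ≈ 1#
      aᵢh≈1 = begin
        a (ρ i) * h                         ≈⟨ ᵥ*ₘ-scale (a (ρ i)) (P i) Y i ⟨
        ((λ q → a (ρ i) * P i q) ᵥ*ₘ Y) i   ≈⟨ ᵥ*ₘ-congˡ Y Bᵢ≈aᵢPᵢ i ⟨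
        (B i ᵥ*ₘ Y) i                       ≈⟨ BY≈I i i ⟩
        Iₘ i i                              ≈⟨ Iₘ-diagonal i ⟩
        1#                                  ∎
        where open ≈-Reasoning

      h≉0 : ¬ h ≈ 0#
      h≉0 h≈0 = 0≉1 (trans (sym (trans (*-congˡ h≈0) (zeroʳ _))) aᵢh≈1)

      t : Carrier
      t = proj₁ (∃[t]g-t*h≉0 R _≟_ g h≉0)

      b′ : ℕ → Carrier
      b′ = b [ ρ i ≔ t ]

      x : Fin n → Carrier
      x q = A i q - t * P i q

      xY≈g-th : (x ᵥ*ₘ Y) i ≈ g - t * h
      xY≈g-th = trans (ᵥ*ₘ-distrib-− (A i) (λ q → t * P i q) Y i) (+-congˡ (-‿cong (ᵥ*ₘ-scale t (P i) Y i)))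

      γ≉0 : ¬ (x ᵥ*ₘ Y) i ≈ 0#
      γ≉0 γ≈0 = proj₂ (∃[t]g-t*h≉0 R _≟_ g h≉0) (trans (sym xY≈g-th) γ≈0)

      δ : Carrier
      δ = proj₁ (inverse _ γ≉0)

      δγ≈1 : δ * (x ᵥ*ₘ Y) i ≈ 1#
      δγ≈1 = trans (*-comm _ _) (proj₂ (inverse _ γ≉0))

      replaced≈mixed : replaceRow B i x ≈ₘ rowMix (S Subset.- i) (D a) (A -ₘ D b′)
      replaced≈mixed p q with p Fin.≟ i
      ... | yes ≡.refl = begin
        A i q - t * P i q                          ≈⟨ +-congˡ (-‿cong (D-update-self b i t q)) ⟨
        (A -ₘ D b′) i q                            ≡⟨ rowMix-outside (S Subset.- i) (D a) (A -ₘ D b′) i q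
                                                        (lookup-remove-self S i) ⟨
        rowMix (S Subset.- i) (D a) (A -ₘ D b′) i q ∎
        where open ≈-Reasoning
      ... | no  p≢i =
        rowMix-cong-row S (S Subset.- i) (D a) (A -ₘ D b) (A -ₘ D b′) p q (≡.sym (lookup-remove-other S p≢i))
          (+-congˡ (-‿cong (sym (D-update-other b t q p≢i))))

    rowMix-singular : ∀ a S b → ¬ Invertible (rowMix S (D a) (A -ₘ D b))
    rowMix-singular a S = go S (<-wellFounded ∣ S ∣)
      where
      go : ∀ S → Acc _<_ ∣ S ∣ → ∀ b → ¬ Invertible (rowMix S (D a) (A -ₘ D b))
      go S (acc smaller) b inv = split (nonempty? S)
        where
        split : Dec (Nonempty S) → ⊥
        split (no  S-empty)     = A-D-singular b (Invertible-cong (rowMix-empty S-empty _ _) inv)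
        split (yes (i , i∈S)) = let b′ , inv′ = invertible-rowMix-remove a S b i∈S inv in
          go (S Subset.- i) (smaller (x∈p⇒∣p-x∣<∣p∣ i∈S)) b′ inv′

    rowMix-D-singular : ∀ a S → ¬ Invertible (rowMix S (D a) A)
    rowMix-D-singular a S inv = rowMix-singular a S (λ _ → 0#) (Invertible-cong A≈A-D0 inv)
      where
      A≈A-D0 : rowMix S (D a) A ≈ₘ rowMix S (D a) (A -ₘ D (λ _ → 0#))
      A≈A-D0 p q = if-congʳ R (lookup S p)
        (sym (trans (+-congˡ (trans (-‿cong (trans (D≈bρ*P _ p q) (zeroˡ _))) -0#≈0#)) (+-identityʳ _)))

-- The argument works for every S and uses only independence of M; m < n just excludes n = 0.
lemma2p5 : ∀ {c ℓ p} (R : CommutativeRing c ℓ) → IsFiniteField R →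
    (m n : ℕ) → 1 ≤ m → m < n →
    (k : ℕ) → 1 ≤ k → k ≤ n → (a : ℕ → CommutativeRing.Carrier R) →
    (M : Mat.Matrix R n → Set p) → Mat.IsMaximalIndependent R M →
    (∀ k′ → 1 ≤ k′ → k′ ≤ n → ∀ a′ → M (Mat.D R n k′ a′)) →
    (A : Mat.Matrix R n) → M A →
    (S : Subset n) → ∣ S ∣ ≡ m →
    ¬ Mat.Invertible R (Mat.rowMix R S (Mat.D R n k a) A)
lemma2p5 R F m ℕ.zero _ ()
lemma2p5 R F m (ℕ.suc n) _ _ k 1≤k k≤n a M (independent , _) D∈M A A∈M S _ =
  rowMix-D-singular a S
  where
  open CommutativeRing R using (1#)
  open IsFiniteField F using (0≉1; inverse; _≟_)
  open MatrixAlgebra R using (D-rowScaled; independent⇒-ₘ-singular)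
  open RowScaledFamily R 0≉1 inverse _≟_
    (Mat.D R (ℕ.suc n) k) (coefficientIndex (ℕ.suc n) k) (coefficientIndex-injective n k≤n)
    (Mat.D R (ℕ.suc n) k (λ _ → 1#)) (D-rowScaled (ℕ.suc n) k)
    A (λ b → independent⇒-ₘ-singular 0≉1 independent A∈M (D∈M k 1≤k k≤n b))
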